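{- Let $v_1,v_2,v_3$ be distinct points of $A_2$. Then there exists a point $v\in A_2$ such that $d^{\rm hex}_3(v_1,v_2,v_3)=d^{\rm hex}(v_1,v)+d^{\rm hex}(v_2,v)+d^{\rm hex}(v_3,v)$.
   Context: Let $\omega=-\tfrac12+\tfrac{\sqrt3}{2}i$. The hexagonal lattice is $A_2=\{x+\omega y: x,y\in\mathbb{Z}\}$. The hexagonal graph has vertex set $A_2$, two points being adjacent iff their Euclidean distance (in $\mathbb{C}$) is $1$. $d^{\rm hex}$ denotes graph distance in the hexagonal graph, and $d^{\rm hex}_3(v_1,v_2,v_3)$ the tristance: the minimum number of edges of a tree in the hexagonal graph (possibly using additional vertices) containing $v_1,v_2,v_3$. -}

module Defs where

open import Data.Nat as ℕ using (ℕ; zero; suc)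
open import Data.Integer as ℤ using (ℤ)
open import Data.Product using (_×_; _,_; proj₁; proj₂; Σ; ∃)
open import Data.Sum using (_⊎_)
open import Data.List using (List; []; _∷_; length)
open import Data.List.Membership.Propositional using (_∈_)
open import Data.List.Relation.Unary.Any using (Any)
open import Data.List.Relation.Unary.AllPairs using (AllPairs)
open import Data.List.Relation.Unary.Unique.Propositional using (Unique)
open import Data.Unit using (⊤)
open import Relation.Nullary using (¬_)
open import Relation.Binary.PropositionalEquality using (_≡_)

-- A point x + ω y of A₂ is represented by the pair (x , y).
Pt : Set
Pt = ℤ × ℤ

-- Squared Euclidean norm |a + ω b|² = a² - a b + b²  (ω = -1/2 + (√3/2) i).
normSq : Pt → ℤ
normSq (a , b) = (a ℤ.* a ℤ.- a ℤ.* b) ℤ.+ b ℤ.* b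

distSq : Pt → Pt → ℤ
distSq (x₁ , y₁) (x₂ , y₂) = normSq (x₂ ℤ.- x₁ , y₂ ℤ.- y₁)

Adj : Pt → Pt → Set
Adj u v = distSq u v ≡ ℤ.+ 1

data Walk : Pt → Pt → ℕ → Set where
  nil  : ∀ {u} → Walk u u 0
  step : ∀ {u w v n} → Adj u w → Walk w v n → Walk u v (suc n)

IsDist : Pt → Pt → ℕ → Set
IsDist u v n = Walk u v n × (∀ m → Walk u v m → n ℕ.≤ m)

Edge : Set
Edge = Pt × Pt

SameEdge : Edge → Edge → Set
SameEdge (a , b) (c , d) = ((a , b) ≡ (c , d)) ⊎ ((a , b) ≡ (d , c))

EdgeIn : List Edge → Pt → Pt → Set
EdgeIn E u v = ((u , v) ∈ E) ⊎ ((v , u) ∈ E)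

VertexIn : List Edge → Pt → Set
VertexIn E v = Any (λ e → (proj₁ e ≡ v) ⊎ (proj₂ e ≡ v)) E

IsSubgraph : List Edge → Set
IsSubgraph E = Data.List.Relation.Unary.All.All (λ e → Adj (proj₁ e) (proj₂ e)) E
             × AllPairs (λ e f → ¬ SameEdge e f) E
  where import Data.List.Relation.Unary.All

data TWalk (E : List Edge) : Pt → Pt → Set where
  tnil  : ∀ {u} → TWalk E u u
  tstep : ∀ {u w v} → EdgeIn E u w → TWalk E w v → TWalk E u v

Connected : List Edge → Set
Connected E = ∀ u v → VertexIn E u → VertexIn E v → TWalk E u v

Chain : List Edge → List Pt → Set
Chain E [] = ⊤
Chain E (x ∷ []) = ⊤
Chain E (x ∷ y ∷ rest) = EdgeIn E x y × Chain E (y ∷ rest)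

lastOf : Pt → List Pt → Pt
lastOf x [] = x
lastOf x (y ∷ ys) = lastOf y ys

IsCycle : List Edge → Pt → List Pt → Set
IsCycle E x cs = (2 ℕ.≤ length cs) × Unique (x ∷ cs) × Chain E (x ∷ cs) × EdgeIn E (lastOf x cs) x

Acyclic : List Edge → Set
Acyclic E = ∀ x cs → ¬ IsCycle E x cs

IsTree : List Edge → Set
IsTree E = IsSubgraph E × Connected E × Acyclic E

TreeThrough : Pt → Pt → Pt → List Edge → Set
TreeThrough v₁ v₂ v₃ E = IsTree E × VertexIn E v₁ × VertexIn E v₂ × VertexIn E v₃

IsTristance : Pt → Pt → Pt → ℕ → Set
IsTristance v₁ v₂ v₃ n =
  (Σ (List Edge) λ E → TreeThrough v₁ v₂ v₃ E × length E ≡ n)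
  × (∀ E → TreeThrough v₁ v₂ v₃ E → n ℕ.≤ length E)

-- The graph distance on A₂ is the hexagonal norm max(|a|, |b|, |a − b|) of the
-- difference, and geodesics are found greedily. Let m minimise the total distance
-- to v₁, v₂, v₃. A tree through the three points contains a path from v₁ to v₂
-- and an edge-disjoint path from v₃ to it, meeting at some c; so it has at least
-- Σ d(vᵢ, c) ≥ Σ d(vᵢ, m) edges. Conversely, growing geodesics from m to the vᵢ
-- one leaf at a time yields a tree with exactly Σ d(vᵢ, m) edges: a new vertex
-- cannot already lie on an earlier geodesic, for it would then have smaller
-- total distance than m.
module Submission where

open import Defs
open import Data.Nat using (ℕ; _+_)
open import Data.Product using (_×_; Σ)
open import Relation.Binary.PropositionalEquality using (_≢_)

open import Data.Empty using (⊥; ⊥-elim)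
open import Data.Fin as Fin using (Fin)
open import Data.Fin.Patterns using (0F; 1F; 2F)
import Data.Fin.Properties as Fin
open import Data.Integer as ℤ using (ℤ; +_; -[1+_]; ∣_∣)
import Data.Integer.Properties as ℤ
open import Data.Integer.Tactic.RingSolver using (solve-∀)
open import Data.Nat as ℕ using (zero; suc; _≤_; _<_; z≤n; s≤s; _⊔_)
import Data.Nat.Properties as ℕ
import Data.Nat.Tactic.RingSolver as ℕ-Solver
open import Algebra.Properties.CommutativeSemigroup ℕ.+-commutativeSemigroup
  using (xy∙z≈xz∙y; xy∙z≈yx∙z; xy∙z≈yz∙x; xy∙z≈zx∙y; xy∙z≈zy∙x)
open import Data.Product using (_,_; proj₁; proj₂)
open import Data.Product.Properties using (≡-dec)
open import Data.Sum using (_⊎_; inj₁; inj₂; [_,_])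
open import Data.Unit using (tt)
open import Data.List using (List; []; _∷_; _++_; length; cartesianProductWith)
open import Data.List.Properties using (length-++; length-removeAt′)
open import Data.List.Membership.Propositional using (_∈_; _∉_)
open import Data.List.Membership.Propositional.Properties
  using (∈-cartesianProductWith⁺; ∈-∃++; ∈-++⁺ˡ; ∈-++⁺ʳ)
open import Data.List.Membership.DecPropositional (≡-dec ℤ._≟_ ℤ._≟_) using (_∈?_)
open import Data.List.Relation.Unary.Any as Any using (Any; here; there; _─_)
open import Data.List.Relation.Unary.All as All using (All; []; _∷_; lookup)
import Data.List.Relation.Unary.All.Properties as All
open import Data.List.Relation.Unary.AllPairs as AllPairs using (AllPairs; []; _∷_)
import Data.List.Relation.Unary.AllPairs.Properties as AllPairs
open import Data.List.Relation.Unary.Unique.Propositional using (Unique)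
open import Data.List.Extrema.Nat using (argmin; f[argmin]≤f[⊤]; f[argmin]≤f[xs])
open import Relation.Nullary using (¬_; yes; no)
open import Relation.Binary.PropositionalEquality
  using (_≡_; refl; sym; trans; cong; cong₂; subst; module ≡-Reasoning)

-- The hexagonal norm and graph distance

-- The unit steps of A₂ are ±(1,0), ±(0,1), ±(1,1): coordinates of equal sign are
-- reduced simultaneously, coordinates of opposite sign one at a time.
hexNorm : ℤ → ℤ → ℕ
hexNorm (+ p)    (+ q)    = p ⊔ q
hexNorm (+ p)    -[1+ q ] = p + suc q
hexNorm -[1+ p ] (+ q)    = suc p + q
hexNorm -[1+ p ] -[1+ q ] = suc p ⊔ suc q

hexNorm≡max : ∀ a b → hexNorm a b ≡ ∣ a ∣ ⊔ ∣ b ∣ ⊔ ∣ a ℤ.- b ∣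
hexNorm≡max (+ p) (+ zero) =
  sym (ℕ.m≥n⇒m⊔n≡m (ℕ.≤-trans (ℕ.≤-reflexive (ℕ.+-identityʳ p)) (ℕ.m≤m⊔n p 0)))
hexNorm≡max (+ p) (+ suc q) = sym (ℕ.m≥n⇒m⊔n≡m (ℤ.∣m⊝n∣≤m⊔n p (suc q)))
hexNorm≡max (+ p) -[1+ q ] = sym (ℕ.m≤n⇒m⊔n≡n (ℕ.m⊔n≤m+n p (suc q)))
hexNorm≡max -[1+ p ] (+ zero) = trans (ℕ.+-identityʳ (suc p)) (sym (ℕ.⊔-idem (suc p)))
hexNorm≡max -[1+ p ] (+ suc q) =
  trans (cong suc (ℕ.+-suc p q))
        (sym (ℕ.m≤n⇒m⊔n≡n (ℕ.≤-trans (ℕ.m⊔n≤m+n (suc p) (suc q)) (ℕ.≤-reflexive (cong suc (ℕ.+-suc p q))))))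
hexNorm≡max -[1+ p ] -[1+ q ] =
  sym (ℕ.m≥n⇒m⊔n≡m (ℕ.≤-trans (ℤ.∣m⊝n∣≤m⊔n (suc q) (suc p)) (ℕ.≤-reflexive (ℕ.⊔-comm (suc q) (suc p)))))

∣a∣≤hexNorm : ∀ a b → ∣ a ∣ ≤ hexNorm a b
∣a∣≤hexNorm a b = subst (∣ a ∣ ≤_) (sym (hexNorm≡max a b))
  (ℕ.≤-trans (ℕ.m≤m⊔n ∣ a ∣ ∣ b ∣) (ℕ.m≤m⊔n _ _))

∣b∣≤hexNorm : ∀ a b → ∣ b ∣ ≤ hexNorm a b
∣b∣≤hexNorm a b = subst (∣ b ∣ ≤_) (sym (hexNorm≡max a b))
  (ℕ.≤-trans (ℕ.m≤n⊔m ∣ a ∣ ∣ b ∣) (ℕ.m≤m⊔n _ _))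

∣a-b∣≤hexNorm : ∀ a b → ∣ a ℤ.- b ∣ ≤ hexNorm a b
∣a-b∣≤hexNorm a b = subst (∣ a ℤ.- b ∣ ≤_) (sym (hexNorm≡max a b)) (ℕ.m≤n⊔m _ _)

hexNorm-triangle : ∀ a b c d → hexNorm (a ℤ.+ c) (b ℤ.+ d) ≤ hexNorm a b + hexNorm c d
hexNorm-triangle a b c d = subst (_≤ hexNorm a b + hexNorm c d) (sym (hexNorm≡max (a ℤ.+ c) (b ℤ.+ d)))
  (ℕ.⊔-lub (ℕ.⊔-lub (bound a c (∣a∣≤hexNorm a b) (∣a∣≤hexNorm c d))
                    (bound b d (∣b∣≤hexNorm a b) (∣b∣≤hexNorm c d)))
           (subst (λ t → ∣ t ∣ ≤ hexNorm a b + hexNorm c d) (sym (regroup a b c d))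
                  (bound (a ℤ.- b) (c ℤ.- d) (∣a-b∣≤hexNorm a b) (∣a-b∣≤hexNorm c d))))
  where
  bound : ∀ x y → ∣ x ∣ ≤ hexNorm a b → ∣ y ∣ ≤ hexNorm c d → ∣ x ℤ.+ y ∣ ≤ hexNorm a b + hexNorm c d
  bound x y x≤ y≤ = ℕ.≤-trans (ℤ.∣i+j∣≤∣i∣+∣j∣ x y) (ℕ.+-mono-≤ x≤ y≤)
  regroup : ∀ a b c d → (a ℤ.+ c) ℤ.- (b ℤ.+ d) ≡ (a ℤ.- b) ℤ.+ (c ℤ.- d)
  regroup = solve-∀

private
  square≡∣∣² : ∀ t → t ℤ.* t ≡ + (∣ t ∣ ℕ.* ∣ t ∣)
  square≡∣∣² (+ n)    = ℤ.+◃n≡+n (n ℕ.* n)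
  square≡∣∣² -[1+ n ] = ℤ.+◃n≡+n (suc n ℕ.* suc n)

  n²≤2⇒n≤1 : ∀ n → n ℕ.* n ≤ 2 → n ≤ 1
  n²≤2⇒n≤1 zero          _   = z≤n
  n²≤2⇒n≤1 (suc zero)    _   = ℕ.≤-refl
  n²≤2⇒n≤1 (suc (suc k)) le = ⊥-elim (ℕ.<⇒≱ (s≤s (s≤s (s≤s z≤n)))
    (ℕ.≤-trans (ℕ.*-mono-≤ {2} {suc (suc k)} {2} {suc (suc k)} (s≤s (s≤s z≤n)) (s≤s (s≤s z≤n))) le))

-- 2 (a² - a b + b²) = a² + b² + (a - b)², so a unit vector has all three of
-- |a|, |b|, |a - b| at most 1.
normSq≡1⇒hexNorm≤1 : ∀ a b → normSq (a , b) ≡ + 1 → hexNorm a b ≤ 1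
normSq≡1⇒hexNorm≤1 a b eq = subst (_≤ 1) (sym (hexNorm≡max a b))
  (ℕ.⊔-lub (ℕ.⊔-lub (n²≤2⇒n≤1 ∣ a ∣ x≤2) (n²≤2⇒n≤1 ∣ b ∣ y≤2)) (n²≤2⇒n≤1 ∣ a ℤ.- b ∣ z≤2))
  where
  x = ∣ a ∣ ℕ.* ∣ a ∣
  y = ∣ b ∣ ℕ.* ∣ b ∣
  z = ∣ a ℤ.- b ∣ ℕ.* ∣ a ℤ.- b ∣
  polarise : ∀ a b → a ℤ.* a ℤ.+ b ℤ.* b ℤ.+ (a ℤ.- b) ℤ.* (a ℤ.- b) ≡ + 2 ℤ.* ((a ℤ.* a ℤ.- a ℤ.* b) ℤ.+ b ℤ.* b)
  polarise = solve-∀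
  sum≡2 : x + y + z ≡ 2
  sum≡2 = ℤ.+-injective (begin
    + (x + y + z)                                   ≡⟨ ℤ.pos-+ (x + y) z ⟩
    + (x + y) ℤ.+ + z                               ≡⟨ cong (ℤ._+ + z) (ℤ.pos-+ x y) ⟩
    + x ℤ.+ + y ℤ.+ + z                             ≡⟨ sym (cong₂ ℤ._+_ (cong₂ ℤ._+_ (square≡∣∣² a) (square≡∣∣² b))
                                                                         (square≡∣∣² (a ℤ.- b))) ⟩
    a ℤ.* a ℤ.+ b ℤ.* b ℤ.+ (a ℤ.- b) ℤ.* (a ℤ.- b) ≡⟨ polarise a b ⟩
    + 2 ℤ.* normSq (a , b)                          ≡⟨ cong (+ 2 ℤ.*_) eq ⟩
    + 2                                             ∎)
    where open ≡-Reasoning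
  x≤2 : x ≤ 2
  x≤2 = ℕ.≤-trans (ℕ.≤-trans (ℕ.m≤m+n x y) (ℕ.m≤m+n _ z)) (ℕ.≤-reflexive sum≡2)
  y≤2 : y ≤ 2
  y≤2 = ℕ.≤-trans (ℕ.≤-trans (ℕ.m≤n+m y x) (ℕ.m≤m+n _ z)) (ℕ.≤-reflexive sum≡2)
  z≤2 : z ≤ 2
  z≤2 = ℕ.≤-trans (ℕ.m≤n+m z _) (ℕ.≤-reflexive sum≡2)

hexNorm-neg : ∀ a b → hexNorm (ℤ.- a) (ℤ.- b) ≡ hexNorm a b
hexNorm-neg (+ zero)  (+ zero)  = refl
hexNorm-neg (+ zero)  (+ suc q) = refl
hexNorm-neg (+ zero)  -[1+ q ]  = refl
hexNorm-neg (+ suc p) (+ zero)  = ℕ.+-identityʳ (suc p)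
hexNorm-neg (+ suc p) (+ suc q) = refl
hexNorm-neg (+ suc p) -[1+ q ]  = refl
hexNorm-neg -[1+ p ]  (+ zero)  = sym (ℕ.+-identityʳ (suc p))
hexNorm-neg -[1+ p ]  (+ suc q) = refl
hexNorm-neg -[1+ p ]  -[1+ q ]  = refl

hexNorm≡0⇒≡0 : ∀ a b → hexNorm a b ≡ 0 → a ≡ + 0 × b ≡ + 0
hexNorm≡0⇒≡0 (+ zero)  (+ zero)  _ = refl , refl
hexNorm≡0⇒≡0 (+ zero)  (+ suc q) ()
hexNorm≡0⇒≡0 (+ suc p) (+ zero)  ()
hexNorm≡0⇒≡0 (+ suc p) (+ suc q) ()
hexNorm≡0⇒≡0 (+ zero)  -[1+ q ]  ()
hexNorm≡0⇒≡0 (+ suc p) -[1+ q ]  ()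
hexNorm≡0⇒≡0 -[1+ p ]  (+ q)     ()
hexNorm≡0⇒≡0 -[1+ p ]  -[1+ q ]  ()

hexNorm-descent : ∀ a b n → hexNorm a b ≡ suc n →
  Σ ℤ λ c → Σ ℤ λ d → normSq (c , d) ≡ + 1 × hexNorm (a ℤ.- c) (b ℤ.- d) ≡ n
hexNorm-descent (+ suc p)      (+ suc q)      n e = + 1 , + 1 , refl , ℕ.suc-injective e
hexNorm-descent (+ suc p)      (+ zero)       n e = + 1 , + 0 , refl , trans (ℕ.⊔-identityʳ p) (ℕ.suc-injective e)
hexNorm-descent (+ suc p)      -[1+ q ]       n e = + 1 , + 0 , refl , ℕ.suc-injective e
hexNorm-descent (+ zero)       (+ suc q)      n e = + 0 , + 1 , refl , ℕ.suc-injective e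
hexNorm-descent (+ zero)       -[1+ zero ]    n e = + 0 , -[1+ 0 ] , refl , ℕ.suc-injective e
hexNorm-descent (+ zero)       -[1+ suc q ]   n e = + 0 , -[1+ 0 ] , refl , ℕ.suc-injective e
hexNorm-descent -[1+ zero ]    (+ q)          n e = -[1+ 0 ] , + 0 , refl , trans (ℕ.+-identityʳ q) (ℕ.suc-injective e)
hexNorm-descent -[1+ suc p ]   (+ q)          n e =
  -[1+ 0 ] , + 0 , refl , trans (cong (λ t → suc p + t) (ℕ.+-identityʳ q)) (ℕ.suc-injective e)
hexNorm-descent -[1+ zero ]    -[1+ zero ]    n e = -[1+ 0 ] , -[1+ 0 ] , refl , ℕ.suc-injective e
hexNorm-descent -[1+ zero ]    -[1+ suc q ]   n e = -[1+ 0 ] , -[1+ 0 ] , refl , ℕ.suc-injective e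
hexNorm-descent -[1+ suc p ]   -[1+ zero ]    n e =
  -[1+ 0 ] , -[1+ 0 ] , refl , trans (ℕ.+-identityʳ (suc p)) (ℕ.suc-injective e)
hexNorm-descent -[1+ suc p ]   -[1+ suc q ]   n e = -[1+ 0 ] , -[1+ 0 ] , refl , ℕ.suc-injective e

hexDist : Pt → Pt → ℕ
hexDist (x₁ , y₁) (x₂ , y₂) = hexNorm (x₂ ℤ.- x₁) (y₂ ℤ.- y₁)

hexDist-sym : ∀ u v → hexDist u v ≡ hexDist v u
hexDist-sym (u₁ , u₂) (v₁ , v₂) =
  trans (sym (hexNorm-neg (v₁ ℤ.- u₁) (v₂ ℤ.- u₂))) (cong₂ hexNorm (neg-diff v₁ u₁) (neg-diff v₂ u₂))
  where
  neg-diff : ∀ a b → ℤ.- (a ℤ.- b) ≡ b ℤ.- a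
  neg-diff = solve-∀

hexDist-self : ∀ u → hexDist u u ≡ 0
hexDist-self (u₁ , u₂) rewrite ℤ.+-inverseʳ u₁ | ℤ.+-inverseʳ u₂ = refl

hexDist≡0⇒≡ : ∀ u v → hexDist u v ≡ 0 → u ≡ v
hexDist≡0⇒≡ (u₁ , u₂) (v₁ , v₂) e with hexNorm≡0⇒≡0 (v₁ ℤ.- u₁) (v₂ ℤ.- u₂) e
... | e₁ , e₂ = sym (cong₂ _,_ (ℤ.i-j≡0⇒i≡j v₁ u₁ e₁) (ℤ.i-j≡0⇒i≡j v₂ u₂ e₂))

∣Δx∣≤hexDist : ∀ u v → ∣ proj₁ v ℤ.- proj₁ u ∣ ≤ hexDist u v
∣Δx∣≤hexDist (u₁ , u₂) (v₁ , v₂) = ∣a∣≤hexNorm (v₁ ℤ.- u₁) (v₂ ℤ.- u₂)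

∣Δy∣≤hexDist : ∀ u v → ∣ proj₂ v ℤ.- proj₂ u ∣ ≤ hexDist u v
∣Δy∣≤hexDist (u₁ , u₂) (v₁ , v₂) = ∣b∣≤hexNorm (v₁ ℤ.- u₁) (v₂ ℤ.- u₂)

Adj-sym : ∀ {u w} → Adj u w → Adj w u
Adj-sym {u₁ , u₂} {w₁ , w₂} adj = trans (normSq-swap w₁ u₁ w₂ u₂) adj
  where
  normSq-swap : ∀ a b c d →
    (b ℤ.- a) ℤ.* (b ℤ.- a) ℤ.- (b ℤ.- a) ℤ.* (d ℤ.- c) ℤ.+ (d ℤ.- c) ℤ.* (d ℤ.- c) ≡
    (a ℤ.- b) ℤ.* (a ℤ.- b) ℤ.- (a ℤ.- b) ℤ.* (c ℤ.- d) ℤ.+ (c ℤ.- d) ℤ.* (c ℤ.- d)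
  normSq-swap = solve-∀

Adj-irrefl : ∀ u → ¬ Adj u u
Adj-irrefl (a , b) adj rewrite ℤ.+-inverseʳ a | ℤ.+-inverseʳ b with adj
... | ()

Adj⇒hexDist≤suc : ∀ {u w} z → Adj u w → hexDist u z ≤ suc (hexDist w z)
Adj⇒hexDist≤suc {u₁ , u₂} {w₁ , w₂} (z₁ , z₂) adj = begin
  hexNorm (z₁ ℤ.- u₁) (z₂ ℤ.- u₂)
    ≡⟨ cong₂ hexNorm (split z₁ u₁ w₁) (split z₂ u₂ w₂) ⟩
  hexNorm ((z₁ ℤ.- w₁) ℤ.+ (w₁ ℤ.- u₁)) ((z₂ ℤ.- w₂) ℤ.+ (w₂ ℤ.- u₂))
    ≤⟨ hexNorm-triangle (z₁ ℤ.- w₁) (z₂ ℤ.- w₂) (w₁ ℤ.- u₁) (w₂ ℤ.- u₂) ⟩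
  hexNorm (z₁ ℤ.- w₁) (z₂ ℤ.- w₂) + hexNorm (w₁ ℤ.- u₁) (w₂ ℤ.- u₂)
    ≤⟨ ℕ.+-monoʳ-≤ (hexNorm (z₁ ℤ.- w₁) (z₂ ℤ.- w₂)) (normSq≡1⇒hexNorm≤1 (w₁ ℤ.- u₁) (w₂ ℤ.- u₂) adj) ⟩
  hexNorm (z₁ ℤ.- w₁) (z₂ ℤ.- w₂) + 1
    ≡⟨ ℕ.+-comm (hexNorm (z₁ ℤ.- w₁) (z₂ ℤ.- w₂)) 1 ⟩
  suc (hexNorm (z₁ ℤ.- w₁) (z₂ ℤ.- w₂)) ∎
  where
  open ℕ.≤-Reasoning
  split : ∀ z u w → z ℤ.- u ≡ (z ℤ.- w) ℤ.+ (w ℤ.- u)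
  split = solve-∀

hexDist-descent : ∀ u z n → hexDist u z ≡ suc n → Σ Pt λ w → Adj u w × hexDist w z ≡ n
hexDist-descent (u₁ , u₂) (z₁ , z₂) n e with hexNorm-descent (z₁ ℤ.- u₁) (z₂ ℤ.- u₂) n e
... | c , d , unit , e′ =
  (u₁ ℤ.+ c , u₂ ℤ.+ d) ,
  trans (cong normSq (cong₂ _,_ (cancel u₁ c) (cancel u₂ d))) unit ,
  trans (cong₂ hexNorm (shift z₁ u₁ c) (shift z₂ u₂ d)) e′
  where
  cancel : ∀ u c → (u ℤ.+ c) ℤ.- u ≡ c
  cancel = solve-∀
  shift : ∀ z u c → z ℤ.- (u ℤ.+ c) ≡ (z ℤ.- u) ℤ.- c
  shift = solve-∀

hexDist≤length : ∀ {u v n} → Walk u v n → hexDist u v ≤ n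
hexDist≤length {u} nil = ℕ.≤-reflexive (hexDist-self u)
hexDist≤length {v = v} (step adj w) = ℕ.≤-trans (Adj⇒hexDist≤suc v adj) (s≤s (hexDist≤length w))

walkOfLength : ∀ n u v → hexDist u v ≡ n → Walk u v n
walkOfLength zero    u v e = subst (λ x → Walk u x 0) (hexDist≡0⇒≡ u v e) nil
walkOfLength (suc n) u v e with hexDist-descent u v n e
... | w , adj , e′ = step adj (walkOfLength n w v e′)

geodesic : ∀ u v → Walk u v (hexDist u v)
geodesic u v = walkOfLength (hexDist u v) u v refl

hexDist-isDist : ∀ u v → IsDist u v (hexDist u v)
hexDist-isDist u v = geodesic u v , λ _ → hexDist≤length

_++ʷ_ : ∀ {u v w m n} → Walk u v m → Walk v w n → Walk u w (m + n)
nil        ++ʷ q = q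
step adj p ++ʷ q = step adj (p ++ʷ q)

hexDist-triangle : ∀ u v w → hexDist u w ≤ hexDist u v + hexDist v w
hexDist-triangle u v w = hexDist≤length (geodesic u v ++ʷ geodesic v w)

-- Minimisers of the total distance

symRange : ℕ → List ℤ
symRange zero    = + 0 ∷ []
symRange (suc R) = + suc R ∷ -[1+ R ] ∷ symRange R

∈-symRange : ∀ R t → ∣ t ∣ ≤ R → t ∈ symRange R
∈-symRange zero    (+ zero)  _ = here refl
∈-symRange (suc R) (+ zero)  _ = there (there (∈-symRange R (+ zero) z≤n))
∈-symRange (suc R) (+ suc p) le with ℕ.m≤n⇒m<n∨m≡n le
... | inj₁ (s≤s lt) = there (there (∈-symRange R (+ suc p) lt))
... | inj₂ refl     = here refl
∈-symRange (suc R) -[1+ p ] le with ℕ.m≤n⇒m<n∨m≡n le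
... | inj₁ (s≤s lt) = there (there (∈-symRange R -[1+ p ] lt))
... | inj₂ refl     = there (here refl)

-- A function dominating the distance to c exceeds f c outside the ball of
-- radius f c around c, so its minimum over that (finite) ball is global.
minimiser : (f : Pt → ℕ) (c : Pt) → (∀ z → hexDist c z ≤ f z) → Σ Pt λ m → ∀ z → f m ≤ f z
minimiser f (x , y) dominates = m , m-min
  where
  R : ℕ
  R = f (x , y)
  shift : ℤ → ℤ → Pt
  shift s t = (x ℤ.+ s , y ℤ.+ t)
  ball : List Pt
  ball = cartesianProductWith shift (symRange R) (symRange R)
  m : Pt
  m = argmin f (x , y) ball
  unshift : ∀ a b → a ℤ.+ (b ℤ.- a) ≡ b
  unshift = solve-∀
  m-min : ∀ z → f m ≤ f z
  m-min (z₁ , z₂) with hexDist (x , y) (z₁ , z₂) ℕ.≤? R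
  ... | yes near = subst (λ z → f m ≤ f z) (cong₂ _,_ (unshift x z₁) (unshift y z₂))
          (lookup (f[argmin]≤f[xs] {f = f} (x , y) ball)
            (∈-cartesianProductWith⁺ shift
              (∈-symRange R (z₁ ℤ.- x) (ℕ.≤-trans (∣Δx∣≤hexDist (x , y) (z₁ , z₂)) near))
              (∈-symRange R (z₂ ℤ.- y) (ℕ.≤-trans (∣Δy∣≤hexDist (x , y) (z₁ , z₂)) near))))
  ... | no far = ℕ.≤-trans (f[argmin]≤f[⊤] {f = f} (x , y) ball)
          (ℕ.≤-trans (ℕ.<⇒≤ (ℕ.≰⇒> far)) (dominates (z₁ , z₂)))

-- Lower bound: two edge-disjoint paths in any tree

module _ {A B : Set} (R : A → B → Set) where

  Any-─ : ∀ {x x′ ys} → (∀ {y} → R x y → R x′ y → ⊥) →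
          (p : Any (R x) ys) → Any (R x′) ys → Any (R x′) (ys ─ p)
  Any-─ excl (here r)  (here r′) = ⊥-elim (excl r r′)
  Any-─ excl (here _)  (there q) = q
  Any-─ excl (there _) (here r′) = here r′
  Any-─ excl (there p) (there q) = there (Any-─ excl p q)

  represented⇒length≤ : ∀ {xs ys} → All (λ x → Any (R x) ys) xs →
    AllPairs (λ x x′ → ∀ {y} → R x y → R x′ y → ⊥) xs → length xs ≤ length ys
  represented⇒length≤ [] [] = z≤n
  represented⇒length≤ {ys = ys} (p ∷ ps) (excl ∷ excls) = ℕ.≤-trans
    (s≤s (represented⇒length≤ (All.zipWith (λ (e , q) → Any-─ (λ {y} → e {y}) p q) (excl , ps)) excls))
    (ℕ.≤-reflexive (sym (length-removeAt′ ys (Any.index p))))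

SameEdge-shared : ∀ {e e′ f} → SameEdge e f → SameEdge e′ f → SameEdge e e′
SameEdge-shared (inj₁ refl) (inj₁ refl) = inj₁ refl
SameEdge-shared (inj₁ refl) (inj₂ refl) = inj₂ refl
SameEdge-shared (inj₂ refl) (inj₁ refl) = inj₂ refl
SameEdge-shared (inj₂ refl) (inj₂ refl) = inj₁ refl

EdgeIn⇒Any-SameEdge : ∀ {E a b} → EdgeIn E a b → Any (SameEdge (a , b)) E
EdgeIn⇒Any-SameEdge (inj₁ p) = Any.map (λ { refl → inj₁ refl }) p
EdgeIn⇒Any-SameEdge (inj₂ p) = Any.map (λ { refl → inj₂ refl }) p

EdgeIn⇒Adj : ∀ {E a b} → IsSubgraph E → EdgeIn E a b → Adj a b
EdgeIn⇒Adj (adj , _) (inj₁ p) = lookup adj p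
EdgeIn⇒Adj {a = a} {b} (adj , _) (inj₂ p) = Adj-sym {b} {a} (lookup adj p)

distinctEdges⇒length≤ : ∀ E (L : List Edge) → All (λ e → EdgeIn E (proj₁ e) (proj₂ e)) L →
  AllPairs (λ e f → ¬ SameEdge e f) L → length L ≤ length E
distinctEdges⇒length≤ E L inE distinct = represented⇒length≤ SameEdge
  (All.map EdgeIn⇒Any-SameEdge inE)
  (AllPairs.map (λ ¬same {_} s s′ → ¬same (SameEdge-shared s s′)) distinct)

edgesOf : Pt → List Pt → List Edge
edgesOf x []       = []
edgesOf x (y ∷ ys) = (x , y) ∷ edgesOf y ys

length-edgesOf : ∀ x ys → length (edgesOf x ys) ≡ length ys
length-edgesOf x []       = refl
length-edgesOf x (y ∷ ys) = cong suc (length-edgesOf y ys)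

edgesOf-endpoints : ∀ x ys → All (λ e → proj₁ e ∈ x ∷ ys × proj₂ e ∈ x ∷ ys) (edgesOf x ys)
edgesOf-endpoints x []       = []
edgesOf-endpoints x (y ∷ ys) = (here refl , there (here refl)) ∷
  All.map (λ (p , q) → there p , there q) (edgesOf-endpoints y ys)

Chain⇒EdgeIn : ∀ {E} x ys → Chain E (x ∷ ys) → All (λ e → EdgeIn E (proj₁ e) (proj₂ e)) (edgesOf x ys)
Chain⇒EdgeIn x []       _        = []
Chain⇒EdgeIn x (y ∷ ys) (e , ch) = e ∷ Chain⇒EdgeIn y ys ch

Unique⇒edgesOf-distinct : ∀ x ys → Unique (x ∷ ys) → AllPairs (λ e f → ¬ SameEdge e f) (edgesOf x ys)
Unique⇒edgesOf-distinct x []       _          = []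
Unique⇒edgesOf-distinct x (y ∷ ys) (x∉ ∷ un) =
  All.map (λ (p , q) → λ { (inj₁ refl) → lookup x∉ p refl ; (inj₂ refl) → lookup x∉ q refl })
          (edgesOf-endpoints y ys)
  ∷ Unique⇒edgesOf-distinct y ys un

record SimplePath (E : List Edge) (u v : Pt) : Set where
  constructor simplePath
  field
    vertices : List Pt
    chain    : Chain E (u ∷ vertices)
    unique   : Unique (u ∷ vertices)
    ends     : lastOf u vertices ≡ v

suffixFrom : ∀ {E x y} ys → x ∈ y ∷ ys → Chain E (y ∷ ys) → Unique (y ∷ ys) → SimplePath E x (lastOf y ys)
suffixFrom ys        (here refl) ch       un       = simplePath ys ch un refl
suffixFrom (_ ∷ ys)  (there p)   (_ , ch) (_ ∷ un) = suffixFrom ys p ch un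

loopErase : ∀ {E u v} → TWalk E u v → SimplePath E u v
loopErase tnil = simplePath [] tt ([] ∷ []) refl
loopErase {u = u} (tstep {w = w} e walk) with loopErase walk
... | simplePath ps ch un end with u ∈? w ∷ ps
...   | yes u∈ = let simplePath zs ch′ un′ end′ = suffixFrom ps u∈ ch un
                 in simplePath zs ch′ un′ (trans end′ end)
...   | no u∉  = simplePath (w ∷ ps) (e , ch) (All.¬Any⇒All¬ (w ∷ ps) u∉ ∷ un) end

chain⇒hexDist≤ : ∀ {E} → IsSubgraph E → ∀ x xs → Chain E (x ∷ xs) → hexDist x (lastOf x xs) ≤ length xs
chain⇒hexDist≤ sg x []       _        = ℕ.≤-reflexive (hexDist-self x)
chain⇒hexDist≤ sg x (y ∷ ys) (e , ch) =
  ℕ.≤-trans (Adj⇒hexDist≤suc (lastOf y ys) (EdgeIn⇒Adj sg e)) (s≤s (chain⇒hexDist≤ sg y ys ch))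

chain⇒hexDist-via≤ : ∀ {E} → IsSubgraph E → ∀ x xs → Chain E (x ∷ xs) → ∀ {c} → c ∈ x ∷ xs →
  hexDist x c + hexDist c (lastOf x xs) ≤ length xs
chain⇒hexDist-via≤ sg x xs ch (here refl) rewrite hexDist-self x = chain⇒hexDist≤ sg x xs ch
chain⇒hexDist-via≤ sg x (y ∷ ys) (e , ch) {c} (there c∈) = ℕ.≤-trans
  (ℕ.+-monoˡ-≤ (hexDist c (lastOf y ys)) (Adj⇒hexDist≤suc c (EdgeIn⇒Adj sg e)))
  (s≤s (chain⇒hexDist-via≤ sg y ys ch c∈))

record FirstHit (E : List Edge) (P : List Pt) (x : Pt) (xs : List Pt) : Set where
  constructor firstHit
  field
    prefix    : List Pt
    chain     : Chain E (x ∷ prefix)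
    unique    : Unique (x ∷ prefix)
    hits      : lastOf x prefix ∈ P
    avoids    : All (λ e → proj₁ e ∉ P) (edgesOf x prefix)
    ⊆vertices : All (_∈ xs) prefix

firstHitOf : ∀ {E} P x xs → Chain E (x ∷ xs) → Unique (x ∷ xs) → lastOf x xs ∈ P → FirstHit E P x xs
firstHitOf P x xs ch un end∈ with x ∈? P
... | yes x∈ = firstHit [] tt ([] ∷ []) x∈ [] []
firstHitOf P x []       _        _          end∈ | no x∉ = ⊥-elim (x∉ end∈)
firstHitOf P x (y ∷ xs) (e , ch) (x∉ys ∷ un) end∈ | no x∉
  with firstHitOf P y xs ch un end∈
... | firstHit ys ch′ un′ hits avoids ⊆xs =
  firstHit (y ∷ ys) (e , ch′) (All.tabulate x≢ ∷ un′) hits (x∉ ∷ avoids) (here refl ∷ All.map there ⊆xs)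
  where
  x≢ : ∀ {z} → z ∈ y ∷ ys → x ≢ z
  x≢ (here refl) = lookup x∉ys (here refl)
  x≢ (there z∈)  = lookup x∉ys (there (lookup ⊆xs z∈))

connected⇒hexDist-sum≤ : ∀ E v₁ v₂ v₃ → IsSubgraph E → Connected E →
  VertexIn E v₁ → VertexIn E v₂ → VertexIn E v₃ →
  Σ Pt λ c → hexDist v₁ c + hexDist v₂ c + hexDist v₃ c ≤ length E
connected⇒hexDist-sum≤ E v₁ v₂ v₃ sg conn i₁ i₂ i₃
  with loopErase (conn v₁ v₂ i₁ i₂) | loopErase (conn v₃ v₁ i₃ i₁)
... | simplePath ps chP unP endP | simplePath qs chQ unQ endQ
  with firstHitOf (v₁ ∷ ps) v₃ qs chQ unQ (subst (_∈ v₁ ∷ ps) (sym endQ) (here refl))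
... | firstHit ys chY unY c∈P avoids _ = c , bound
  where
  c : Pt
  c = lastOf v₃ ys
  P-edges Y-edges : List Edge
  P-edges = edgesOf v₁ ps
  Y-edges = edgesOf v₃ ys
  disjoint : All (λ e → All (λ f → ¬ SameEdge e f) Y-edges) P-edges
  disjoint = All.map (λ (a∈ , b∈) → All.map (λ c∉ → λ { (inj₁ refl) → c∉ a∈ ; (inj₂ refl) → c∉ b∈ }) avoids)
                     (edgesOf-endpoints v₁ ps)
  edges≤ : length ps + length ys ≤ length E
  edges≤ = subst (_≤ length E)
    (trans (length-++ P-edges) (cong₂ _+_ (length-edgesOf v₁ ps) (length-edgesOf v₃ ys)))
    (distinctEdges⇒length≤ E (P-edges ++ Y-edges)
      (All.++⁺ (Chain⇒EdgeIn v₁ ps chP) (Chain⇒EdgeIn v₃ ys chY))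
      (AllPairs.++⁺ (Unique⇒edgesOf-distinct v₁ ps unP) (Unique⇒edgesOf-distinct v₃ ys unY) disjoint))
  v₁-c-v₂ : hexDist v₁ c + hexDist v₂ c ≤ length ps
  v₁-c-v₂ = subst (λ z → hexDist v₁ c + z ≤ length ps) (trans (cong (hexDist c) endP) (hexDist-sym c v₂))
              (chain⇒hexDist-via≤ sg v₁ ps chP c∈P)
  bound : hexDist v₁ c + hexDist v₂ c + hexDist v₃ c ≤ length E
  bound = ℕ.≤-trans (ℕ.+-mono-≤ v₁-c-v₂ (chain⇒hexDist≤ sg v₃ ys chY)) edges≤

-- Adding a leaf to a tree

∈⇒VertexIn₁ : ∀ {E a b} → (a , b) ∈ E → VertexIn E a
∈⇒VertexIn₁ = Any.map λ { refl → inj₁ refl }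

∈⇒VertexIn₂ : ∀ {E a b} → (a , b) ∈ E → VertexIn E b
∈⇒VertexIn₂ = Any.map λ { refl → inj₂ refl }

EdgeIn-sym : ∀ {E a b} → EdgeIn E a b → EdgeIn E b a
EdgeIn-sym (inj₁ p) = inj₂ p
EdgeIn-sym (inj₂ p) = inj₁ p

lastOf-∈ : ∀ (x : Pt) cs → lastOf x cs ∈ x ∷ cs
lastOf-∈ x []       = here refl
lastOf-∈ x (y ∷ cs) = there (lastOf-∈ y cs)

lastOf-++ : ∀ (x : Pt) ys w zs → lastOf x (ys ++ w ∷ zs) ≡ lastOf w zs
lastOf-++ x []       w zs = refl
lastOf-++ x (y ∷ ys) w zs = lastOf-++ y ys w zs

Chain-++ : ∀ {E} (x : Pt) ys w zs → Chain E (x ∷ ys ++ w ∷ zs) → EdgeIn E (lastOf x ys) w × Chain E (w ∷ zs)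
Chain-++ x []       w zs (e , ch) = e , ch
Chain-++ x (y ∷ ys) w zs (_ , ch) = Chain-++ y ys w zs ch

Unique-++⇒≢ : ∀ (xs : List Pt) {ys a b} → Unique (xs ++ ys) → a ∈ xs → b ∈ ys → a ≢ b
Unique-++⇒≢ (x ∷ xs) (x∉ ∷ _)  (here refl) b∈ = lookup x∉ (∈-++⁺ʳ xs b∈)
Unique-++⇒≢ (x ∷ xs) (_  ∷ un) (there a∈)  b∈ = Unique-++⇒≢ xs un a∈ b∈

module _ {E u w} (w∉E : ¬ VertexIn E w) (uw : Adj u w) where

  private
    G = (u , w) ∷ E

    u≢w : u ≢ w
    u≢w refl = Adj-irrefl u uw

  leaf-neighbour : ∀ {a} → EdgeIn G a w → a ≡ u
  leaf-neighbour (inj₁ (here refl)) = refl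
  leaf-neighbour (inj₁ (there p))   = ⊥-elim (w∉E (∈⇒VertexIn₂ p))
  leaf-neighbour (inj₂ (here refl)) = ⊥-elim (u≢w refl)
  leaf-neighbour (inj₂ (there p))   = ⊥-elim (w∉E (∈⇒VertexIn₁ p))

  EdgeIn-unleaf : ∀ {a b} → EdgeIn G a b → a ≢ w → b ≢ w → EdgeIn E a b
  EdgeIn-unleaf (inj₁ (here refl)) _   b≢w = ⊥-elim (b≢w refl)
  EdgeIn-unleaf (inj₁ (there p))   _   _   = inj₁ p
  EdgeIn-unleaf (inj₂ (here refl)) a≢w _   = ⊥-elim (a≢w refl)
  EdgeIn-unleaf (inj₂ (there p))   _   _   = inj₂ p

  Chain-unleaf : ∀ x cs → Chain G (x ∷ cs) → w ∉ x ∷ cs → Chain E (x ∷ cs)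
  Chain-unleaf x []       _        _   = tt
  Chain-unleaf x (y ∷ cs) (e , ch) w∉ =
    EdgeIn-unleaf e (λ { refl → w∉ (here refl) }) (λ { refl → w∉ (there (here refl)) }) ,
    Chain-unleaf y cs ch (λ w∈ → w∉ (there w∈))

  -- A vertex of a cycle has two distinct cycle neighbours, but the leaf w has
  -- only the neighbour u; so a cycle of G avoids w and lies in E.
  Acyclic-addLeaf : Acyclic E → Acyclic G
  Acyclic-addLeaf acyclic x cs (2≤ , un , ch , closing) with w ∈? x ∷ cs
  ... | no w∉ = acyclic x cs (2≤ , un , Chain-unleaf x cs ch w∉ ,
          EdgeIn-unleaf closing (λ { refl → w∉ (lastOf-∈ x cs) }) (λ { refl → w∉ (here refl) }))
  ... | yes (here refl) = w-first cs 2≤ un ch closing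
    where
    w-first : ∀ cs → 2 ≤ length cs → Unique (w ∷ cs) → Chain G (w ∷ cs) → EdgeIn G (lastOf w cs) w → ⊥
    w-first (_ ∷ [])       (s≤s ()) _ _ _
    w-first (c₁ ∷ c₂ ∷ cs) _ (_ ∷ un) (e , _) closing =
      Unique-++⇒≢ (c₁ ∷ []) un (here refl) (lastOf-∈ c₂ cs)
        (trans (leaf-neighbour (EdgeIn-sym e)) (sym (leaf-neighbour closing)))
  ... | yes (there w∈) with ∈-∃++ w∈
  ...   | ys , zs , refl = w-later ys zs ch closing un 2≤
    where
    w-later : ∀ ys zs → Chain G (x ∷ ys ++ w ∷ zs) → EdgeIn G (lastOf x (ys ++ w ∷ zs)) x →
              Unique (x ∷ ys ++ w ∷ zs) → 2 ≤ length (ys ++ w ∷ zs) → ⊥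
    w-later []       []       _  _       _  (s≤s ())
    w-later (y ∷ ys) []       ch closing un _ =
      Unique-++⇒≢ (x ∷ []) un (here refl) (∈-++⁺ˡ (lastOf-∈ y ys))
        (trans (leaf-neighbour (EdgeIn-sym (subst (λ a → EdgeIn G a x) (lastOf-++ y ys w []) closing)))
               (sym (leaf-neighbour (proj₁ (Chain-++ x (y ∷ ys) w [] ch)))))
    w-later ys       (z ∷ zs) ch _       un _ with Chain-++ x ys w (z ∷ zs) ch
    ... | before , after , _ =
      Unique-++⇒≢ (x ∷ ys) un (lastOf-∈ x ys) (there (here refl))
        (trans (leaf-neighbour before) (sym (leaf-neighbour (EdgeIn-sym after))))

  IsSubgraph-addLeaf : IsSubgraph E → IsSubgraph G
  IsSubgraph-addLeaf (adj , distinct) = (uw ∷ adj) , (All.tabulate new ∷ distinct)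
    where
    new : ∀ {f} → f ∈ E → ¬ SameEdge (u , w) f
    new p (inj₁ refl) = w∉E (∈⇒VertexIn₂ p)
    new p (inj₂ refl) = w∉E (∈⇒VertexIn₁ p)

  Connected-addLeaf : Connected E → VertexIn E u ⊎ E ≡ [] → Connected G
  Connected-addLeaf conn u∈E a b a∈ b∈ = to-u a∈ ◅◅ from-u b∈
    where
    _◅◅_ : ∀ {a b c} → TWalk G a b → TWalk G b c → TWalk G a c
    tnil      ◅◅ q = q
    tstep e p ◅◅ q = tstep e (p ◅◅ q)
    lift : ∀ {a b} → TWalk E a b → TWalk G a b
    lift tnil               = tnil
    lift (tstep (inj₁ p) r) = tstep (inj₁ (there p)) (lift r)
    lift (tstep (inj₂ p) r) = tstep (inj₂ (there p)) (lift r)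
    in-E : ∀ {a} → VertexIn E a → VertexIn E u
    in-E = [ (λ u∈ _ → u∈) , (λ { refl () }) ] u∈E
    to-u : ∀ {a} → VertexIn G a → TWalk G a u
    to-u (here (inj₁ refl)) = tnil
    to-u (here (inj₂ refl)) = tstep (inj₂ (here refl)) tnil
    to-u (there a∈)         = lift (conn _ u a∈ (in-E a∈))
    from-u : ∀ {b} → VertexIn G b → TWalk G u b
    from-u (here (inj₁ refl)) = tnil
    from-u (here (inj₂ refl)) = tstep (inj₁ (here refl)) tnil
    from-u (there b∈)         = lift (conn u _ (in-E b∈) b∈)

  IsTree-addLeaf : IsTree E → VertexIn E u ⊎ E ≡ [] → IsTree G
  IsTree-addLeaf (sg , conn , acyclic) u∈E =
    IsSubgraph-addLeaf sg , Connected-addLeaf conn u∈E , Acyclic-addLeaf acyclic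

IsTree-[] : IsTree []
IsTree-[] = ([] , []) , (λ _ _ ()) , λ { _ (c ∷ _) (_ , _ , (inj₁ () , _) , _)
                                       ; _ (c ∷ _) (_ , _ , (inj₂ () , _) , _) }

-- Upper bound: geodesics grown from a minimiser

sum3 : (Fin 3 → ℕ) → ℕ
sum3 f = f 0F + f 1F + f 2F

sum3-split : ∀ {i j : Fin 3} → i ≢ j → Σ (Fin 3) λ l → ∀ f → sum3 f ≡ f i + f j + f l
sum3-split {0F} {0F} i≢j = ⊥-elim (i≢j refl)
sum3-split {0F} {1F} _   = 2F , λ f → refl
sum3-split {0F} {2F} _   = 1F , λ f → xy∙z≈xz∙y (f 0F) (f 1F) (f 2F)
sum3-split {1F} {0F} _   = 2F , λ f → xy∙z≈yx∙z (f 0F) (f 1F) (f 2F)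
sum3-split {1F} {1F} i≢j = ⊥-elim (i≢j refl)
sum3-split {1F} {2F} _   = 0F , λ f → xy∙z≈yz∙x (f 0F) (f 1F) (f 2F)
sum3-split {2F} {0F} _   = 1F , λ f → xy∙z≈zx∙y (f 0F) (f 1F) (f 2F)
sum3-split {2F} {1F} _   = 0F , λ f → xy∙z≈zy∙x (f 0F) (f 1F) (f 2F)
sum3-split {2F} {2F} i≢j = ⊥-elim (i≢j refl)

private
  exchange : ∀ {a b c p s A B C} → a + p ≡ A → b + s ≡ B → c ≤ C + s → a + b + c + p ≤ A + B + C
  exchange {a} {b} {c} {p} {s} {A} {B} {C} refl refl c≤ = begin
    a + b + c + p           ≡⟨ regroup a b c p ⟩
    (a + p) + b + c         ≤⟨ ℕ.+-monoʳ-≤ ((a + p) + b) c≤ ⟩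
    (a + p) + b + (C + s)   ≡⟨ regroup′ (a + p) b C s ⟩
    (a + p) + (b + s) + C   ∎
    where
    open ℕ.≤-Reasoning
    regroup : ∀ a b c p → a + b + c + p ≡ (a + p) + b + c
    regroup = ℕ-Solver.solve-∀
    regroup′ : ∀ x b C s → x + b + (C + s) ≡ x + (b + s) + C
    regroup′ = ℕ-Solver.solve-∀

module SteinerTree (v : Fin 3 → Pt) (m : Pt)
  (m-min : ∀ z → sum3 (λ i → hexDist (v i) m) ≤ sum3 (λ i → hexDist (v i) z)) where

  D : Fin 3 → ℕ
  D i = hexDist (v i) m

  -- c lies k steps along a geodesic from m towards v j.
  AtStep : Fin 3 → ℕ → Pt → Set
  AtStep j k c = hexDist (v j) c + k ≡ D j × hexDist c m ≤ k

  -- A point p ≥ 1 steps along the geodesic to v i and s steps along the one to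
  -- v j would beat m: moving to it gains p on the first leg and s on the second
  -- while costing at most s on the third.
  two-legs-impossible : ∀ {i j p s w} → i ≢ j → 1 ≤ p → AtStep i p w → AtStep j s w → ⊥
  two-legs-impossible {i} {j} {p} {s} {w} i≢j 1≤p (onᵢ , _) (onⱼ , near) with sum3-split i≢j
  ... | l , split = ℕ.<⇒≱ better (m-min w)
    where
    H : Fin 3 → ℕ
    H x = hexDist (v x) w
    third : H l ≤ D l + s
    third = ℕ.≤-trans (hexDist-triangle (v l) m w)
                      (ℕ.+-monoʳ-≤ (D l) (subst (_≤ s) (hexDist-sym w m) near))
    better : sum3 H < sum3 D
    better = begin-strict
      sum3 H                ≡⟨ split H ⟩
      H i + H j + H l       <⟨ ℕ.≤-trans (ℕ.≤-reflexive (ℕ.+-comm 1 _)) (ℕ.+-monoʳ-≤ _ 1≤p) ⟩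
      H i + H j + H l + p   ≤⟨ exchange {H i} {H j} {H l} {p} {s} onᵢ onⱼ third ⟩
      D i + D j + D l       ≡⟨ sym (split D) ⟩
      sum3 D                ∎
      where open ℕ.≤-Reasoning

  Reached : List Edge → Pt → Set
  Reached E c = VertexIn E c ⊎ c ≡ m

  Labelled : Fin 3 → ℕ → Pt → Set
  Labelled j k z = z ≡ m ⊎ Σ (Fin 3) λ i → Σ ℕ λ p →
    1 ≤ p × AtStep i p z × (i Fin.< j ⊎ i ≡ j × p ≤ k)

  record Built (j : Fin 3) (k : ℕ) (E : List Edge) : Set where
    field
      tree     : IsTree E
      rooted   : VertexIn E m ⊎ E ≡ []
      labelled : ∀ {z} → VertexIn E z → Labelled j k z

  Built-[] : Built 0F 0 []
  Built-[] = record { tree = IsTree-[] ; rooted = inj₂ refl ; labelled = λ () }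

  Built-advance : ∀ {j j′ k E} → j Fin.< j′ → Built j k E → Built j′ 0 E
  Built-advance {j} {j′} {k} {E} j<j′ built = record
    { tree = tree ; rooted = rooted ; labelled = λ z∈ → relabel (labelled z∈) }
    where
    open Built built
    relabel : ∀ {z} → Labelled j k z → Labelled j′ 0 z
    relabel (inj₁ z≡m) = inj₁ z≡m
    relabel (inj₂ (i , p , 1≤p , at , inj₁ i<j))         = inj₂ (i , p , 1≤p , at , inj₁ (Fin.<-trans i<j j<j′))
    relabel (inj₂ (i , p , 1≤p , at , inj₂ (refl , _))) = inj₂ (i , p , 1≤p , at , inj₁ j<j′)

  Labelled-suc : ∀ {j k z} → Labelled j k z → Labelled j (suc k) z
  Labelled-suc (inj₁ z≡m) = inj₁ z≡m
  Labelled-suc (inj₂ (i , p , 1≤p , at , inj₁ i<j))        = inj₂ (i , p , 1≤p , at , inj₁ i<j)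
  Labelled-suc (inj₂ (i , p , 1≤p , at , inj₂ (i≡j , p≤k))) = inj₂ (i , p , 1≤p , at , inj₂ (i≡j , ℕ.m≤n⇒m≤1+n p≤k))

  fresh : ∀ {j k w} → AtStep j (suc k) w → ¬ Labelled j k w
  fresh {j} {k} (at , _) (inj₁ refl) = ℕ.m+1+n≢m (D j) at
  fresh atʷ (inj₂ (i , p , 1≤p , atⁱ , inj₁ i<j)) = two-legs-impossible (Fin.<⇒≢ i<j) 1≤p atⁱ atʷ
  fresh {k = k} {w} (at , _) (inj₂ (j , p , _ , (atᵖ , _) , inj₂ (refl , p≤k))) =
    ℕ.<-irrefl refl (subst (_≤ k) (ℕ.+-cancelˡ-≡ (hexDist (v j) w) p (suc k) (trans atᵖ (sym at))) p≤k)

  Reached-leaf : ∀ {E c} → VertexIn E m ⊎ E ≡ [] → Reached E c → VertexIn E c ⊎ E ≡ []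
  Reached-leaf _      (inj₁ c∈E)  = inj₁ c∈E
  Reached-leaf rooted (inj₂ refl) = rooted

  rooted-addLeaf : ∀ {E c w} → VertexIn E m ⊎ E ≡ [] → Reached E c → VertexIn ((c , w) ∷ E) m
  rooted-addLeaf (inj₁ m∈E) _           = there m∈E
  rooted-addLeaf (inj₂ refl) (inj₂ refl) = here (inj₁ refl)

  record Step (j : Fin 3) (k : ℕ) (c : Pt) (E : List Edge) (r : ℕ) : Set where
    field
      next    : Pt
      built   : Built j (suc k) ((c , next) ∷ E)
      at-next : AtStep j (suc k) next
      dist    : hexDist (v j) next ≡ r

  step-towards : ∀ {j k c r E} → Built j k E → Reached E c → AtStep j k c → hexDist (v j) c ≡ suc r →
    Step j k c E r
  step-towards {j} {k} {c} {r} {E} built c∈ (atᶜ , nearᶜ) dist = record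
    { next = w ; built = built′ ; at-next = atʷ ; dist = trans (hexDist-sym (v j) w) dist′ }
    where
    open Built built
    descent : Σ Pt λ w → Adj c w × hexDist w (v j) ≡ r
    descent = hexDist-descent c (v j) r (trans (hexDist-sym c (v j)) dist)
    w : Pt
    w = proj₁ descent
    cw : Adj c w
    cw = proj₁ (proj₂ descent)
    dist′ : hexDist w (v j) ≡ r
    dist′ = proj₂ (proj₂ descent)
    atʷ : AtStep j (suc k) w
    atʷ = trans (cong (_+ suc k) (trans (hexDist-sym (v j) w) dist′))
                (trans (ℕ.+-suc r k) (trans (cong (_+ k) (sym dist)) atᶜ)) ,
          ℕ.≤-trans (Adj⇒hexDist≤suc m (Adj-sym {c} {w} cw)) (s≤s nearᶜ)
    labelled′ : ∀ {z} → VertexIn ((c , w) ∷ E) z → Labelled j (suc k) z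
    labelled′ (here (inj₁ refl)) = [ (λ c∈E → Labelled-suc (labelled c∈E)) , inj₁ ] c∈
    labelled′ (here (inj₂ refl)) = inj₂ (j , suc k , s≤s z≤n , atʷ , inj₂ (refl , ℕ.≤-refl))
    labelled′ (there z∈)         = Labelled-suc (labelled z∈)
    built′ : Built j (suc k) ((c , w) ∷ E)
    built′ = record
      { tree     = IsTree-addLeaf (λ w∈ → fresh atʷ (labelled w∈)) cw tree (Reached-leaf rooted c∈)
      ; rooted   = inj₁ (rooted-addLeaf rooted c∈)
      ; labelled = labelled′ }

  record Leg (j : Fin 3) (E : List Edge) (r : ℕ) : Set where
    field
      {steps}  : ℕ
      edges    : List Edge
      built    : Built j steps edges
      reaches  : Reached edges (v j)
      length≡  : length edges ≡ r + length E
      extends  : ∀ {z} → Reached E z → Reached edges z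

  leg-from : ∀ {j k c E} r → Built j k E → Reached E c → AtStep j k c → hexDist (v j) c ≡ r → Leg j E r
  leg-from {j} {c = c} {E} zero built c∈ _ dist = record
    { edges = E ; built = built ; reaches = subst (Reached E) (sym (hexDist≡0⇒≡ (v j) c dist)) c∈
    ; length≡ = refl ; extends = λ z∈ → z∈ }
  leg-from {E = E} (suc r) builtᴱ c∈ atᶜ distᶜ = record
    { edges = edges ; built = built ; reaches = reaches
    ; length≡ = trans length≡ (ℕ.+-suc r (length E))
    ; extends = λ { (inj₁ z∈) → extends (inj₁ (there z∈)) ; (inj₂ z≡m) → extends (inj₂ z≡m) } }
    where
    module S = Step (step-towards builtᴱ c∈ atᶜ distᶜ)
    open Leg (leg-from r S.built (inj₁ (here (inj₂ refl))) S.at-next S.dist)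

  leg : ∀ j {E} → Built j 0 E → Leg j E (D j)
  leg j built = leg-from (D j) built (inj₂ refl) (ℕ.+-identityʳ (D j) , ℕ.≤-reflexive (hexDist-self m)) refl

  steinerTree : v 0F ≢ v 1F →
    Σ (List Edge) λ E → TreeThrough (v 0F) (v 1F) (v 2F) E × length E ≡ sum3 D
  steinerTree v₀≢v₁ = edges , (tree , vertex reaches₀ , vertex reaches₁ , vertex reaches) , length-tree
    where
    L₀ : Leg 0F [] (D 0F)
    L₀ = leg 0F Built-[]
    L₁ : Leg 1F (Leg.edges L₀) (D 1F)
    L₁ = leg 1F (Built-advance (s≤s z≤n) (Leg.built L₀))
    open Leg (leg 2F (Built-advance (s≤s (s≤s z≤n)) (Leg.built L₁)))
    open Built built
    reaches₀ : Reached edges (v 0F)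
    reaches₀ = extends (Leg.extends L₁ (Leg.reaches L₀))
    reaches₁ : Reached edges (v 1F)
    reaches₁ = extends (Leg.reaches L₁)
    at-root : ∀ {z} → Reached [] z → z ≡ m
    at-root (inj₂ z≡m) = z≡m
    nonempty : edges ≢ []
    nonempty e = v₀≢v₁ (trans (at-root (subst (λ E → Reached E (v 0F)) e reaches₀))
                              (sym (at-root (subst (λ E → Reached E (v 1F)) e reaches₁))))
    m∈edges : VertexIn edges m ⊎ edges ≡ [] → VertexIn edges m
    m∈edges (inj₁ m∈) = m∈
    m∈edges (inj₂ e)  = ⊥-elim (nonempty e)
    vertex : ∀ {z} → Reached edges z → VertexIn edges z
    vertex (inj₁ z∈)   = z∈
    vertex (inj₂ refl) = m∈edges rooted
    length-tree : length edges ≡ sum3 D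
    length-tree = trans length≡ (trans (cong (λ n → D 2F + n) (trans (Leg.length≡ L₁) (cong (λ n → D 1F + n) (Leg.length≡ L₀))))
                                       (reorder (D 0F) (D 1F) (D 2F)))
      where
      reorder : ∀ a b c → c + (b + (a + 0)) ≡ a + b + c
      reorder = ℕ-Solver.solve-∀

lemma21 : (v₁ v₂ v₃ : Pt) → v₁ ≢ v₂ → v₁ ≢ v₃ → v₂ ≢ v₃ →
    Σ Pt λ v → Σ ℕ λ d₁ → Σ ℕ λ d₂ → Σ ℕ λ d₃ →
      IsDist v₁ v d₁ × IsDist v₂ v d₂ × IsDist v₃ v d₃ × IsTristance v₁ v₂ v₃ (d₁ + d₂ + d₃)
lemma21 v₁ v₂ v₃ v₁≢v₂ _ _ =
  m , hexDist v₁ m , hexDist v₂ m , hexDist v₃ m ,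
  hexDist-isDist v₁ m , hexDist-isDist v₂ m , hexDist-isDist v₃ m ,
  SteinerTree.steinerTree v m m-min v₁≢v₂ , optimal
  where
  v : Fin 3 → Pt
  v 0F = v₁
  v 1F = v₂
  v 2F = v₃
  total : Pt → ℕ
  total z = sum3 (λ i → hexDist (v i) z)
  fermat : Σ Pt λ m → ∀ z → total m ≤ total z
  fermat = minimiser total v₁ (λ z → ℕ.≤-trans (ℕ.m≤m+n _ _) (ℕ.m≤m+n _ _))
  m : Pt
  m = proj₁ fermat
  m-min : ∀ z → total m ≤ total z
  m-min = proj₂ fermat
  optimal : ∀ E → TreeThrough v₁ v₂ v₃ E → total m ≤ length E
  optimal E ((sg , conn , _) , i₁ , i₂ , i₃) with connected⇒hexDist-sum≤ E v₁ v₂ v₃ sg conn i₁ i₂ i₃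
  ... | c , total-c≤ = ℕ.≤-trans (m-min c) total-c≤
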